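{- Let $q$ be an odd prime power and let $Q$ be a nondegenerate quadratic form on $\mathbb{F}_q^d$. Let $P \subseteq \mathbb{F}_q^d$, and let $S$ be a set of $Q$-spheres (with arbitrary radii in $\mathbb{F}_q$, zero allowed). Then \[\left|I(P,S) - q^{ -1}|P|\,|S|\right| \leq \sqrt{q^d|P|\,|S|}.\]
   Context: $\mathbb{F}_q$ is the finite field with $q$ elements. A quadratic form $Q(x) = \sum_{i,j} a_{ij}x_ix_j$ with $a_{ij}=a_{ji}$ is nondegenerate if the symmetric matrix $(a_{ij})$ is non-singular. The $Q$-sphere with center $y \in \mathbb{F}_q^d$ and radius $r \in \mathbb{F}_q$ is $\{x \in \mathbb{F}_q^d : Q(x-y) = r\}$; a sphere is specified by its center and radius. For $P \subseteq \mathbb{F}_q^d$ and a set $S$ of spheres, $I(P,S) = \#\{(x,s) \in P \times S : x \in s\}$. -}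

module Defs where

open import Level using (0ℓ)
open import Data.Nat as ℕ using (ℕ; zero; suc)
open import Data.Fin using (Fin; zero; suc)
open import Data.List as List using (List; []; _∷_; length; filter; cartesianProduct)
open import Data.List.Relation.Unary.AllPairs using (AllPairs)
open import Data.Product using (_×_; _,_; Σ; ∃)
open import Relation.Binary.PropositionalEquality using (_≡_)
open import Relation.Nullary using (¬_; Dec; yes; no)
open import Data.Fin as Fin using ()
open import Algebra.Structures using (IsCommutativeRing)
open import Function.Bundles using (_↔_)

record FiniteField : Set₁ where
  infixl 7 _*_
  infixl 6 _+_
  infix 8 -_
  field
    Carrier : Set
    _+_ _*_ : Carrier → Carrier → Carrier
    -_      : Carrier → Carrier
    0# 1#   : Carrier
    isCommutativeRing : IsCommutativeRing _≡_ _+_ _*_ -_ 0# 1#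
    0≢1     : ¬ (0# ≡ 1#)
    inverse : ∀ x → ¬ (x ≡ 0#) → Σ Carrier (λ y → x * y ≡ 1#)
    _≟_     : (x y : Carrier) → Dec (x ≡ y)
    size      : ℕ
    enumerate : Fin size ↔ Carrier

module _ (F : FiniteField) where
  open FiniteField F

  infixl 6 _-_
  _-_ : Carrier → Carrier → Carrier
  x - y = x + (- y)

  ∑ : ∀ {n} → (Fin n → Carrier) → Carrier
  ∑ {zero}  f = 0#
  ∑ {suc n} f = f zero + ∑ (λ i → f (suc i))

  Vec : ℕ → Set
  Vec d = Fin d → Carrier

  _⊖_ : ∀ {d} → Vec d → Vec d → Vec d
  (x ⊖ y) i = x i - y i

  Matrix : ℕ → Set
  Matrix d = Fin d → Fin d → Carrier

  _·_ : ∀ {d} → Matrix d → Matrix d → Matrix d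
  (A · B) i j = ∑ (λ k → A i k * B k j)

  identity : ∀ {d} → Matrix d
  identity i j with i Fin.≟ j
  ... | yes _ = 1#
  ... | no  _ = 0#

  Symmetric : ∀ {d} → Matrix d → Set
  Symmetric A = ∀ i j → A i j ≡ A j i

  NonSingular : ∀ {d} → Matrix d → Set
  NonSingular {d} A = Σ (Matrix d) λ B →
    (∀ i j → (A · B) i j ≡ identity i j) × (∀ i j → (B · A) i j ≡ identity i j)

  quadForm : ∀ {d} → Matrix d → Vec d → Carrier
  quadForm A x = ∑ (λ i → ∑ (λ j → A i j * x i * x j))

  Sphere : ℕ → Set
  Sphere d = Vec d × Carrier

  OnSphere : ∀ {d} → Matrix d → Vec d → Sphere d → Set
  OnSphere A x (y , r) = quadForm A (x ⊖ y) ≡ r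

  -- finite sets of points / spheres: duplicate-free lists
  DistinctVec : ∀ {d} → Vec d → Vec d → Set
  DistinctVec x y = ¬ (∀ i → x i ≡ y i)

  DistinctSphere : ∀ {d} → Sphere d → Sphere d → Set
  DistinctSphere (y , r) (y' , r') = ¬ ((∀ i → y i ≡ y' i) × r ≡ r')

  PointSet : ℕ → Set
  PointSet d = Σ (List (Vec d)) (AllPairs DistinctVec)

  SphereSet : ℕ → Set
  SphereSet d = Σ (List (Sphere d)) (AllPairs DistinctSphere)

  incidences : ∀ {d} → Matrix d → List (Vec d) → List (Sphere d) → ℕ
  incidences A P S =
    length (filter (λ { (x , (y , r)) → quadForm A (x ⊖ y) ≟ r }) (cartesianProduct P S))

module Submission where

-- Let N σ be the number of points of P on the sphere σ. Then q I − p s = ∑_{σ ∈ S} (q N σ − p), so by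
-- Cauchy–Schwarz (q I − p s)² ≤ s ∑_σ (q N σ − p)², where the sum may be extended to all q^(d+1) spheres.
-- Over all spheres ∑ N = q^d p, and ∑ N² counts the triples (x, x′, y) with x, x′ ∈ P and
-- Q(x − y) = Q(x′ − y). For x ≠ x′ such centres y solve Q x′ + (∇Q x − ∇Q x′)·y = Q x, an affine equation
-- whose linear part is nonzero because A is nonsingular and 2 ≠ 0 (q is odd), so there are at most
-- q^(d−1) of them. Expanding the square then gives ∑_σ (q N σ − p)² ≤ q^(d+2) p.

open import Level using (0ℓ)
open import Data.Nat as ℕ using (ℕ; zero; suc; z≤n; _%_)
import Data.Nat.Properties as ℕP
open import Data.Nat.DivMod using (m*n%n≡0)
open import Data.Integer as ℤ using (ℤ; +_; 0ℤ; _≤_; +≤+; _^_)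
import Data.Integer.Properties as ℤP
open import Data.Integer.Tactic.RingSolver using (solve-∀)
open import Data.Fin using (Fin; zero; suc; punchIn)
import Data.Fin as Fin
import Data.Fin.Properties as FinP
import Data.Vec.Functional as Vector
open import Data.List using (List; []; _∷_; length; map; _++_; concatMap; filter; cartesianProduct; tabulate)
open import Data.List.Properties using (length-tabulate)
open import Data.List.Relation.Unary.All as All using (All; []; _∷_)
open import Data.List.Relation.Unary.Any as Any using (Any; here; there; _─_)
import Data.List.Relation.Unary.Any.Properties as AnyP
open import Data.List.Relation.Unary.AllPairs using (AllPairs; []; _∷_)
import Data.List.Relation.Unary.AllPairs.Properties as AllPairsP
open import Data.List.Membership.Propositional using (_∈_)
open import Data.List.Membership.Propositional.Properties using (∈-tabulate⁺)
open import Data.Product using (_×_; _,_; ∃)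
open import Data.Product.Relation.Binary.Pointwise.NonDependent using (×-setoid)
open import Data.Empty using (⊥-elim)
open import Function using (_∘_; _⟨_⟩_)
open import Function.Bundles using (Inverse; Injection)
open import Function.Properties.Inverse using (Inverse⇒Injection)
open import Relation.Nullary using (Dec; yes; no; ¬_)
open import Relation.Binary.Bundles using (Setoid)
open import Relation.Binary.Definitions using (DecidableEquality; tri<; tri≈; tri>)
open import Relation.Binary.PropositionalEquality
  using (_≡_; _≢_; _≗_; refl; sym; trans; cong; cong₂; subst; setoid; _→-setoid_; module ≡-Reasoning)
open import Algebra.Bundles using (CommutativeRing)
import Algebra.Properties.AbelianGroup as AbelianGroupProperties
import Algebra.Properties.Ring as RingProperties
import Algebra.Properties.Semiring.Sum as SemiringSum
open import Defs
  using (FiniteField; Vec; Matrix; identity; Symmetric; NonSingular; quadForm; Sphere; OnSphere; DistinctVec;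
         incidences)
import Defs

module IntegerSum where
  open import Data.Integer using (_+_; _-_; -_; _*_)

  private
    variable
      A B : Set
      P Q : Set

  ∑ℤ : List A → (A → ℤ) → ℤ
  ∑ℤ []       f = 0ℤ
  ∑ℤ (x ∷ xs) f = f x + ∑ℤ xs f

  syntax ∑ℤ xs (λ x → e) = ∑[ x ∈ xs ] e

  module _ {f g : A → ℤ} where

    ∑ℤ-cong : ∀ xs → (∀ x → f x ≡ g x) → ∑ℤ xs f ≡ ∑ℤ xs g
    ∑ℤ-cong []       f≗g = refl
    ∑ℤ-cong (x ∷ xs) f≗g = cong₂ _+_ (f≗g x) (∑ℤ-cong xs f≗g)

    ∑ℤ-mono-≤ : ∀ xs → (∀ x → f x ≤ g x) → ∑ℤ xs f ≤ ∑ℤ xs g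
    ∑ℤ-mono-≤ []       f≤g = ℤP.≤-refl
    ∑ℤ-mono-≤ (x ∷ xs) f≤g = ℤP.+-mono-≤ (f≤g x) (∑ℤ-mono-≤ xs f≤g)

  ∑ℤ-distrib-+ : ∀ xs (f g : A → ℤ) → ∑[ x ∈ xs ] (f x + g x) ≡ ∑ℤ xs f + ∑ℤ xs g
  ∑ℤ-distrib-+ []       f g = refl
  ∑ℤ-distrib-+ (x ∷ xs) f g = trans (cong (_+_ (f x + g x)) (∑ℤ-distrib-+ xs f g)) (shuffle (f x) (g x) _ _)
    where
    shuffle : ∀ a b c d → a + b + (c + d) ≡ a + c + (b + d)
    shuffle = solve-∀

  ∑ℤ-distrib-- : ∀ xs (f g : A → ℤ) → ∑[ x ∈ xs ] (f x - g x) ≡ ∑ℤ xs f - ∑ℤ xs g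
  ∑ℤ-distrib-- []       f g = refl
  ∑ℤ-distrib-- (x ∷ xs) f g = trans (cong (_+_ (f x - g x)) (∑ℤ-distrib-- xs f g)) (shuffle (f x) (g x) _ _)
    where
    shuffle : ∀ a b c d → a - b + (c - d) ≡ a + c - (b + d)
    shuffle = solve-∀

  ∑ℤ-*ˡ : ∀ xs c (f : A → ℤ) → ∑[ x ∈ xs ] (c * f x) ≡ c * ∑ℤ xs f
  ∑ℤ-*ˡ []       c f = sym (ℤP.*-zeroʳ c)
  ∑ℤ-*ˡ (x ∷ xs) c f = trans (cong (_+_ (c * f x)) (∑ℤ-*ˡ xs c f)) (sym (ℤP.*-distribˡ-+ c (f x) _))

  ∑ℤ-*ʳ : ∀ xs c (f : A → ℤ) → ∑[ x ∈ xs ] (f x * c) ≡ ∑ℤ xs f * c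
  ∑ℤ-*ʳ xs c f = trans (∑ℤ-cong xs (λ x → ℤP.*-comm (f x) c)) (trans (∑ℤ-*ˡ xs c f) (ℤP.*-comm c _))

  ∑ℤ-const : ∀ (xs : List A) c → ∑[ x ∈ xs ] c ≡ + length xs * c
  ∑ℤ-const []       c = sym (ℤP.*-zeroˡ c)
  ∑ℤ-const (x ∷ xs) c = trans (cong (_+_ c) (∑ℤ-const xs c)) (sym (ℤP.suc-* (+ length xs) c))

  ∑ℤ-++ : ∀ xs ys (f : A → ℤ) → ∑ℤ (xs ++ ys) f ≡ ∑ℤ xs f + ∑ℤ ys f
  ∑ℤ-++ []       ys f = sym (ℤP.+-identityˡ _)
  ∑ℤ-++ (x ∷ xs) ys f = trans (cong (_+_ (f x)) (∑ℤ-++ xs ys f)) (sym (ℤP.+-assoc (f x) _ _))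

  ∑ℤ-map : ∀ (h : A → B) xs (f : B → ℤ) → ∑ℤ (map h xs) f ≡ ∑[ x ∈ xs ] f (h x)
  ∑ℤ-map h []       f = refl
  ∑ℤ-map h (x ∷ xs) f = cong (_+_ (f (h x))) (∑ℤ-map h xs f)

  ∑ℤ-concatMap : ∀ (h : A → List B) xs (f : B → ℤ) → ∑ℤ (concatMap h xs) f ≡ ∑[ x ∈ xs ] ∑ℤ (h x) f
  ∑ℤ-concatMap h []       f = refl
  ∑ℤ-concatMap h (x ∷ xs) f =
    trans (∑ℤ-++ (h x) (concatMap h xs) f) (cong (_+_ (∑ℤ (h x) f)) (∑ℤ-concatMap h xs f))

  ∑ℤ-zero : ∀ (xs : List A) → ∑[ x ∈ xs ] 0ℤ ≡ 0ℤ
  ∑ℤ-zero xs = trans (∑ℤ-const xs 0ℤ) (ℤP.*-zeroʳ (+ length xs))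

  ∑ℤ-All-zero : ∀ {xs} {f : A → ℤ} → All (λ x → f x ≡ 0ℤ) xs → ∑ℤ xs f ≡ 0ℤ
  ∑ℤ-All-zero []            = refl
  ∑ℤ-All-zero (fx≡0 ∷ f≡0) = cong₂ _+_ fx≡0 (∑ℤ-All-zero f≡0)

  ∑ℤ-comm : ∀ xs ys (f : A → B → ℤ) → ∑[ x ∈ xs ] ∑[ y ∈ ys ] f x y ≡ ∑[ y ∈ ys ] ∑[ x ∈ xs ] f x y
  ∑ℤ-comm []       ys f = sym (∑ℤ-zero ys)
  ∑ℤ-comm (x ∷ xs) ys f =
    trans (cong (_+_ (∑ℤ ys (f x))) (∑ℤ-comm xs ys f)) (sym (∑ℤ-distrib-+ ys (f x) _))

  ∑ℤ-*-∑ℤ : ∀ xs (f g : A → ℤ) → ∑ℤ xs f * ∑ℤ xs g ≡ ∑[ x ∈ xs ] ∑[ x′ ∈ xs ] (f x * g x′)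
  ∑ℤ-*-∑ℤ xs f g = trans (sym (∑ℤ-*ʳ xs (∑ℤ xs g) f)) (∑ℤ-cong xs (λ x → sym (∑ℤ-*ˡ xs (f x) g)))

  ∑ℤ-nonneg : ∀ xs {f : A → ℤ} → (∀ x → 0ℤ ≤ f x) → 0ℤ ≤ ∑ℤ xs f
  ∑ℤ-nonneg xs 0≤f = subst (_≤ ∑ℤ xs _) (∑ℤ-zero xs) (∑ℤ-mono-≤ xs 0≤f)

  ∑ℤ-All-≤ : ∀ {xs} {f : A → ℤ} {c} → All (λ x → f x ≤ c) xs → ∑ℤ xs f ≤ + length xs * c
  ∑ℤ-All-≤ {xs = xs} {c = c} f≤c =
    subst (_ ≤_) (∑ℤ-const xs c) (∑ℤ-mono-All f≤c)
    where
    ∑ℤ-mono-All : ∀ {xs} {f : A → ℤ} → All (λ x → f x ≤ c) xs → ∑ℤ xs f ≤ ∑[ x ∈ xs ] c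
    ∑ℤ-mono-All []           = ℤP.≤-refl
    ∑ℤ-mono-All (fx≤c ∷ f≤c) = ℤP.+-mono-≤ fx≤c (∑ℤ-mono-All f≤c)

  ∑ℤ-quadratic : ∀ xs α β γ (f : A → ℤ) →
    ∑[ x ∈ xs ] (α * (f x * f x) + β * f x + γ) ≡
    α * ∑[ x ∈ xs ] (f x * f x) + β * ∑ℤ xs f + + length xs * γ
  ∑ℤ-quadratic xs α β γ f = begin
    ∑[ x ∈ xs ] (α * (f x * f x) + β * f x + γ)
      ≡⟨ ∑ℤ-distrib-+ xs _ (λ _ → γ) ⟩
    ∑[ x ∈ xs ] (α * (f x * f x) + β * f x) + ∑[ x ∈ xs ] γ
      ≡⟨ cong₂ _+_ (∑ℤ-distrib-+ xs _ _) (∑ℤ-const xs γ) ⟩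
    ∑[ x ∈ xs ] (α * (f x * f x)) + ∑[ x ∈ xs ] (β * f x) + + length xs * γ
      ≡⟨ cong (_+ + length xs * γ) (cong₂ _+_ (∑ℤ-*ˡ xs α _) (∑ℤ-*ˡ xs β f)) ⟩
    α * ∑[ x ∈ xs ] (f x * f x) + β * ∑ℤ xs f + + length xs * γ ∎
    where open ≡-Reasoning

  square-nonneg : ∀ i → 0ℤ ≤ i * i
  square-nonneg (+ n)      = subst (0ℤ ≤_) (ℤP.pos-* n n) (+≤+ z≤n)
  square-nonneg ℤ.-[1+ n ] = +≤+ z≤n

  *-nonneg : ∀ i j → 0ℤ ≤ i → 0ℤ ≤ j → 0ℤ ≤ i * j
  *-nonneg (+ m) (+ n) _ _ = subst (0ℤ ≤_) (ℤP.pos-* m n) (+≤+ z≤n)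

  ∑ℤ-square-≤ : ∀ xs (a : A → ℤ) → ∑ℤ xs a * ∑ℤ xs a ≤ + length xs * ∑[ x ∈ xs ] (a x * a x)
  ∑ℤ-square-≤ xs a =
    ℤP.*-cancelʳ-≤-pos _ _ (+ 2) (ℤP.0≤i-j⇒j≤i (subst (0ℤ ≤_) spread≡ spread-nonneg))
    where
    n  = + length xs
    S₁ = ∑ℤ xs a
    S₂ = ∑[ x ∈ xs ] (a x * a x)
    spread = ∑[ x ∈ xs ] ∑[ y ∈ xs ] ((a x - a y) * (a x - a y))

    spread-nonneg : 0ℤ ≤ spread
    spread-nonneg = ∑ℤ-nonneg xs (λ x → ∑ℤ-nonneg xs (λ y → square-nonneg (a x - a y)))

    expand : ∀ u v → (u - v) * (u - v) ≡ + 1 * (v * v) + - (+ 2 * u) * v + u * u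
    expand = solve-∀
    regroup : ∀ n S₁ S₂ u → + 1 * S₂ + - (+ 2 * u) * S₁ + n * (u * u) ≡ n * (u * u) + - (+ 2 * S₁) * u + S₂
    regroup = solve-∀
    collect : ∀ n S₁ S₂ → n * S₂ + - (+ 2 * S₁) * S₁ + n * S₂ ≡ n * S₂ * + 2 - S₁ * S₁ * + 2
    collect = solve-∀

    inner : ∀ x → ∑[ y ∈ xs ] ((a x - a y) * (a x - a y)) ≡ n * (a x * a x) + - (+ 2 * S₁) * a x + S₂
    inner x = trans (∑ℤ-cong xs (λ y → expand (a x) (a y)))
      (trans (∑ℤ-quadratic xs (+ 1) (- (+ 2 * a x)) (a x * a x) a) (regroup n S₁ S₂ (a x)))

    spread≡ : spread ≡ n * S₂ * + 2 - S₁ * S₁ * + 2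
    spread≡ = trans (∑ℤ-cong xs inner) (trans (∑ℤ-quadratic xs n (- (+ 2 * S₁)) S₂ a) (collect n S₁ S₂))

  ∑ℤ-∑ℤ-≤ : {R : A → A → Set} → (∀ {x y} → R x y → R y x) →
    (g : A → A → ℤ) (D O : ℤ) → (∀ x → g x x ≤ D) → (∀ {x y} → R x y → g x y ≤ O) →
    ∀ {xs} → AllPairs R xs →
    ∑[ x ∈ xs ] ∑[ y ∈ xs ] g x y ≤ + length xs * D + (+ length xs * + length xs - + length xs) * O
  ∑ℤ-∑ℤ-≤ R-sym g D O diag off [] = ℤP.≤-refl
  ∑ℤ-∑ℤ-≤ R-sym g D O diag off {x ∷ xs} (Rx ∷ Rxs) = begin
    ∑[ u ∈ x ∷ xs ] ∑[ v ∈ x ∷ xs ] g u v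
      ≡⟨ cong (_+_ (g x x + ∑ℤ xs (g x))) (∑ℤ-distrib-+ xs (λ u → g u x) _) ⟩
    (g x x + ∑ℤ xs (g x)) + (∑[ u ∈ xs ] g u x + ∑[ u ∈ xs ] ∑[ v ∈ xs ] g u v)
      ≤⟨ ℤP.+-mono-≤ (ℤP.+-mono-≤ (diag x) (∑ℤ-All-≤ (All.map off Rx)))
                     (ℤP.+-mono-≤ (∑ℤ-All-≤ (All.map (off ∘ R-sym) Rx))
                                  (∑ℤ-∑ℤ-≤ R-sym g D O diag off Rxs)) ⟩
    (D + n * O) + (n * O + (n * D + (n * n - n) * O))
      ≡⟨ regroup n D O ⟩
    (+ 1 + n) * D + ((+ 1 + n) * (+ 1 + n) - (+ 1 + n)) * O ∎
    where
    open ℤP.≤-Reasoning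
    n = + length xs
    regroup : ∀ n D O → (D + n * O) + (n * O + (n * D + (n * n - n) * O)) ≡
                        (+ 1 + n) * D + ((+ 1 + n) * (+ 1 + n) - (+ 1 + n)) * O
    regroup = solve-∀

  module _ (S : Setoid 0ℓ 0ℓ) where
    open Setoid S using (_≈_) renaming (Carrier to X; refl to ≈-refl; sym to ≈-sym; trans to ≈-trans)
    open import Data.List.Membership.Setoid S using () renaming (_∈_ to _∈ₛ_)
    open import Data.List.Relation.Binary.Subset.Setoid S using (_⊆_)
    open import Data.List.Relation.Unary.Unique.Setoid S using (Unique)

    private
      ∑ℤ-─ : ∀ {P : X → Set} ys (p : Any P ys) (f : X → ℤ) → ∑ℤ ys f ≡ f (Any.lookup p) + ∑ℤ (ys ─ p) f
      ∑ℤ-─ (y ∷ ys) (here _)  f = refl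
      ∑ℤ-─ (y ∷ ys) (there p) f =
        trans (cong (_+_ (f y)) (∑ℤ-─ ys p f)) (swap (f y) (f (Any.lookup p)) (∑ℤ (ys ─ p) f))
        where
        swap : ∀ a b c → a + (b + c) ≡ b + (a + c)
        swap = solve-∀

      ∈-─⁺ : ∀ {P : X → Set} {z} ys (p : Any P ys) → z ∈ₛ ys → ¬ z ≈ Any.lookup p → z ∈ₛ (ys ─ p)
      ∈-─⁺ (y ∷ ys) (here _)  (here z≈y)   z≉y = ⊥-elim (z≉y z≈y)
      ∈-─⁺ (y ∷ ys) (here _)  (there z∈ys) z≉y = z∈ys
      ∈-─⁺ (y ∷ ys) (there p) (here z≈y)   z≉y = here z≈y
      ∈-─⁺ (y ∷ ys) (there p) (there z∈ys) z≉y = there (∈-─⁺ ys p z∈ys z≉y)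

    ∑ℤ-mono-⊆ : (f : X → ℤ) → (∀ {x y} → x ≈ y → f x ≡ f y) → (∀ x → 0ℤ ≤ f x) →
      ∀ {xs} ys → Unique xs → xs ⊆ ys → ∑ℤ xs f ≤ ∑ℤ ys f
    ∑ℤ-mono-⊆ f f-resp f≥0 ys [] _ = ∑ℤ-nonneg ys f≥0
    ∑ℤ-mono-⊆ f f-resp f≥0 {x ∷ xs} ys (x≉xs ∷ unique) x∷xs⊆ys = begin
      f x + ∑ℤ xs f                  ≤⟨ ℤP.+-mono-≤ (ℤP.≤-reflexive (f-resp x≈x′))
                                           (∑ℤ-mono-⊆ f f-resp f≥0 (ys ─ x∈ys) unique xs⊆ys─x) ⟩
      f x′ + ∑ℤ (ys ─ x∈ys) f        ≡⟨ sym (∑ℤ-─ ys x∈ys f) ⟩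
      ∑ℤ ys f                        ∎
      where
      open ℤP.≤-Reasoning
      x∈ys = x∷xs⊆ys (here ≈-refl)
      x′ = Any.lookup x∈ys
      x≈x′ : x ≈ x′
      x≈x′ = AnyP.lookup-result x∈ys
      xs⊆ys─x : xs ⊆ (ys ─ x∈ys)
      xs⊆ys─x z∈xs with All.lookupAny x≉xs z∈xs
      ... | x≉w , z≈w =
        ∈-─⁺ ys x∈ys (x∷xs⊆ys (there z∈xs)) (λ z≈x′ → x≉w (≈-trans x≈x′ (≈-trans (≈-sym z≈x′) z≈w)))

  𝟙 : {P : Set} → Dec P → ℤ
  𝟙 (yes _) = + 1
  𝟙 (no _)  = 0ℤ

  𝟙-yes : (p? : Dec P) → P → 𝟙 p? ≡ + 1
  𝟙-yes (yes _) _ = refl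
  𝟙-yes (no ¬p) p = ⊥-elim (¬p p)

  𝟙-no : (p? : Dec P) → ¬ P → 𝟙 p? ≡ 0ℤ
  𝟙-no (yes p) ¬p = ⊥-elim (¬p p)
  𝟙-no (no _)  _  = refl

  𝟙-nonneg : (p? : Dec P) → 0ℤ ≤ 𝟙 p?
  𝟙-nonneg (yes _) = +≤+ z≤n
  𝟙-nonneg (no _)  = ℤP.≤-refl

  𝟙-≤1 : (p? : Dec P) → 𝟙 p? ≤ + 1
  𝟙-≤1 (yes _) = ℤP.≤-refl
  𝟙-≤1 (no _)  = +≤+ z≤n

  𝟙-mono : (p? : Dec P) (q? : Dec Q) → (P → Q) → 𝟙 p? ≤ 𝟙 q?
  𝟙-mono (yes p) (yes _) P⇒Q = ℤP.≤-refl
  𝟙-mono (yes p) (no ¬q) P⇒Q = ⊥-elim (¬q (P⇒Q p))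
  𝟙-mono (no _)  q?      P⇒Q = 𝟙-nonneg q?

  𝟙-cong : (p? : Dec P) (q? : Dec Q) → (P → Q) → (Q → P) → 𝟙 p? ≡ 𝟙 q?
  𝟙-cong p? q? P⇒Q Q⇒P = ℤP.≤-antisym (𝟙-mono p? q? P⇒Q) (𝟙-mono q? p? Q⇒P)

  module _ {P : A → Set} (P? : ∀ x → Dec (P x)) where

    length-filter : ∀ xs → + length (filter P? xs) ≡ ∑[ x ∈ xs ] 𝟙 (P? x)
    length-filter []       = refl
    length-filter (x ∷ xs) with P? x
    ... | yes _ = cong (_+_ (+ 1)) (length-filter xs)
    ... | no  _ = trans (length-filter xs) (sym (ℤP.+-identityˡ _))

    ∑ℤ-𝟙-≤1 : ∀ {xs} → AllPairs _≢_ xs → (∀ {x y} → P x → P y → x ≡ y) → ∑[ x ∈ xs ] 𝟙 (P? x) ≤ + 1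
    ∑ℤ-𝟙-≤1 [] P-unique = +≤+ z≤n
    ∑ℤ-𝟙-≤1 {x ∷ xs} (x∉xs ∷ distinct) P-unique with P? x
    ... | yes Px = ℤP.≤-reflexive (cong (_+_ (+ 1))
                     (∑ℤ-All-zero (All.map (λ x≢y → 𝟙-no (P? _) (x≢y ∘ P-unique Px)) x∉xs)))
    ... | no  _  = subst (_≤ + 1) (sym (ℤP.+-identityˡ _)) (∑ℤ-𝟙-≤1 distinct P-unique)

  length-filter-cartesianProduct : {R : A × B → Set} (R? : ∀ z → Dec (R z)) (xs : List A) (ys : List B) →
    + length (filter R? (cartesianProduct xs ys)) ≡ ∑[ x ∈ xs ] ∑[ y ∈ ys ] 𝟙 (R? (x , y))
  length-filter-cartesianProduct R? xs ys = trans (length-filter R? (cartesianProduct xs ys)) (split xs)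
    where
    split : ∀ xs → ∑[ z ∈ cartesianProduct xs ys ] 𝟙 (R? z) ≡ ∑[ x ∈ xs ] ∑[ y ∈ ys ] 𝟙 (R? (x , y))
    split []       = refl
    split (x ∷ xs) = trans (∑ℤ-++ (map (x ,_) ys) (cartesianProduct xs ys) _)
                           (cong₂ _+_ (∑ℤ-map (x ,_) ys (𝟙 ∘ R?)) (split xs))

  ∑ℤ-sift : (_≟_ : DecidableEquality A) → ∀ {xs a} → AllPairs _≢_ xs → a ∈ xs → (g : A → ℤ) →
    ∑[ c ∈ xs ] (𝟙 (a ≟ c) * g c) ≡ g a
  ∑ℤ-sift _≟_ {x ∷ xs} (x∉xs ∷ _) (here refl) g = trans
    (cong₂ _+_ (trans (cong (_* g x) (𝟙-yes (x ≟ x) refl)) (ℤP.*-identityˡ (g x)))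
               (∑ℤ-All-zero (All.map (λ x≢c → cong (_* g _) (𝟙-no (x ≟ _) x≢c)) x∉xs)))
    (ℤP.+-identityʳ (g x))
  ∑ℤ-sift _≟_ {x ∷ xs} {a} (x∉xs ∷ distinct) (there a∈xs) g = trans
    (cong₂ _+_ (cong (_* g x) (𝟙-no (a ≟ x) (All.lookup x∉xs a∈xs ∘ sym))) (∑ℤ-sift _≟_ distinct a∈xs g))
    (ℤP.+-identityˡ (g a))

module FiniteGeometry (F : FiniteField) where
  open IntegerSum
  open import Data.Integer using () renaming (_+_ to _⊕_; _*_ to _⊗_)
  open FiniteField F

  infixl 6 _-_ _⊖_
  _-_ : Carrier → Carrier → Carrier
  _-_ = Defs._-_ F

  _⊖_ : ∀ {d} → Vec F d → Vec F d → Vec F d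
  _⊖_ = Defs._⊖_ F

  commutativeRing : CommutativeRing _ _
  commutativeRing = record { isCommutativeRing = isCommutativeRing }

  open CommutativeRing commutativeRing
    using (+-assoc; +-identityˡ; +-identityʳ; zeroʳ; *-comm; *-assoc; *-identityˡ; *-identityʳ; distribʳ;
           ring; commutativeSemiring; semiring; +-abelianGroup)
  open AbelianGroupProperties +-abelianGroup using (∙-cancelˡ; ∙-cancelʳ; //-rightDividesˡ; x∙y⁻¹≈ε⇒x≈y)
  open RingProperties ring using (-1*x≈-x; [y-z]x≈yx-zx)
  open SemiringSum semiring using (sum; sum-cong-≗; ∑-distrib-+; ∑-comm; *-distribˡ-sum; *-distribʳ-sum;
                                   sum-remove; sum-replicate-zero)
  open import Algebra.Solver.Ring.NaturalCoefficients.Default commutativeSemiring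

  ∑≡sum : ∀ {n} (f : Fin n → Carrier) → Defs.∑ F f ≡ sum f
  ∑≡sum {zero}  f = refl
  ∑≡sum {suc n} f = cong (_+_ (f zero)) (∑≡sum (f ∘ suc))

  sum-neg : ∀ {n} (f : Fin n → Carrier) → sum (λ i → - f i) ≡ - sum f
  sum-neg f = begin
    sum (λ i → - f i)         ≡⟨ sum-cong-≗ (λ i → sym (-1*x≈-x (f i))) ⟩
    sum (λ i → - 1# * f i)    ≡⟨ sym (*-distribˡ-sum (- 1#) f) ⟩
    - 1# * sum f              ≡⟨ -1*x≈-x (sum f) ⟩
    - sum f                   ∎
    where open ≡-Reasoning

  *-cancelˡ-≢0 : ∀ a {b c} → a ≢ 0# → a * b ≡ a * c → b ≡ c
  *-cancelˡ-≢0 a {b} {c} a≢0 ab≡ac with inverse a a≢0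
  ... | a⁻¹ , aa⁻¹≡1 = begin
    b                ≡⟨ sym (*-identityˡ b) ⟩
    1# * b           ≡⟨ cong (_* b) (trans (sym aa⁻¹≡1) (*-comm a a⁻¹)) ⟩
    a⁻¹ * a * b      ≡⟨ *-assoc a⁻¹ a b ⟩
    a⁻¹ * (a * b)    ≡⟨ cong (a⁻¹ *_) ab≡ac ⟩
    a⁻¹ * (a * c)    ≡⟨ sym (*-assoc a⁻¹ a c) ⟩
    a⁻¹ * a * c      ≡⟨ cong (_* c) (trans (*-comm a⁻¹ a) aa⁻¹≡1) ⟩
    1# * c           ≡⟨ *-identityˡ c ⟩
    c                ∎
    where open ≡-Reasoning

  x+x-injective : 1# + 1# ≢ 0# → ∀ {a b} → a + a ≡ b + b → a ≡ b
  x+x-injective 2≢0 {a} {b} a+a≡b+b = *-cancelˡ-≢0 (1# + 1#) 2≢0 (begin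
    (1# + 1#) * a   ≡⟨ double a ⟩
    a + a           ≡⟨ a+a≡b+b ⟩
    b + b           ≡⟨ sym (double b) ⟩
    (1# + 1#) * b   ∎)
    where
    open ≡-Reasoning
    double : ∀ x → (1# + 1#) * x ≡ x + x
    double = solve 1 (λ x → (con 1 :+ con 1) :* x := x :+ x) refl

  -- Enumerating F and Fᵈ

  q : ℤ
  q = + size

  0≤q^ : ∀ n → 0ℤ ≤ q ^ n
  0≤q^ zero    = +≤+ ℕ.z≤n
  0≤q^ (suc n) = *-nonneg q (q ^ n) (+≤+ ℕ.z≤n) (0≤q^ n)

  allF : List Carrier
  allF = tabulate (Inverse.to enumerate)

  allF-unique : AllPairs _≢_ allF
  allF-unique = AllPairsP.tabulate⁺ (λ i≢j → i≢j ∘ Injection.injective (Inverse⇒Injection enumerate))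

  ∈-allF : ∀ a → a ∈ allF
  ∈-allF a = subst (_∈ allF) (Inverse.strictlyInverseˡ enumerate a) (∈-tabulate⁺ (Inverse.from enumerate a))

  ∑ℤ-allF-const : ∀ c → ∑[ r ∈ allF ] c ≡ q ⊗ c
  ∑ℤ-allF-const c = trans (∑ℤ-const allF c) (cong (λ n → + n ⊗ c) (length-tabulate (Inverse.to enumerate)))

  ∑ℤ-allF-sift : ∀ t (g : Carrier → ℤ) → ∑[ r ∈ allF ] (𝟙 (t ≟ r) ⊗ g r) ≡ g t
  ∑ℤ-allF-sift t = ∑ℤ-sift _≟_ allF-unique (∈-allF t)

  ∑ℤ-allF-𝟙≟ : ∀ t → ∑[ r ∈ allF ] 𝟙 (t ≟ r) ≡ + 1
  ∑ℤ-allF-𝟙≟ t = trans (∑ℤ-cong allF (λ r → sym (ℤP.*-identityʳ (𝟙 (t ≟ r))))) (∑ℤ-allF-sift t (λ _ → + 1))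

  ∑ℤ-allF-involution : (h : Carrier → Carrier) → (∀ r → h (h r) ≡ r) →
    (g : Carrier → ℤ) → ∑[ r ∈ allF ] g (h r) ≡ ∑ℤ allF g
  ∑ℤ-allF-involution h h-involutive g = begin
    ∑[ r ∈ allF ] g (h r)                                 ≡⟨ ∑ℤ-cong allF (λ r → sym (∑ℤ-allF-sift (h r) g)) ⟩
    ∑[ r ∈ allF ] ∑[ c ∈ allF ] (𝟙 (h r ≟ c) ⊗ g c)       ≡⟨ ∑ℤ-comm allF allF _ ⟩
    ∑[ c ∈ allF ] ∑[ r ∈ allF ] (𝟙 (h r ≟ c) ⊗ g c)       ≡⟨ ∑ℤ-cong allF (λ c → ∑ℤ-*ʳ allF (g c) _) ⟩
    ∑[ c ∈ allF ] (∑[ r ∈ allF ] 𝟙 (h r ≟ c) ⊗ g c)       ≡⟨ ∑ℤ-cong allF (λ c → cong (_⊗ g c) (preimage-count c)) ⟩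
    ∑[ c ∈ allF ] (+ 1 ⊗ g c)                             ≡⟨ ∑ℤ-cong allF (λ c → ℤP.*-identityˡ (g c)) ⟩
    ∑ℤ allF g                                             ∎
    where
    open ≡-Reasoning
    preimage-count : ∀ c → ∑[ r ∈ allF ] 𝟙 (h r ≟ c) ≡ + 1
    preimage-count c = trans (∑ℤ-cong allF (λ r → 𝟙-cong (h r ≟ c) (h c ≟ r)
                                           (λ hr≡c → trans (cong h (sym hr≡c)) (h-involutive r))
                                           (λ hc≡r → trans (cong h (sym hc≡r)) (h-involutive c))))
                             (∑ℤ-allF-𝟙≟ (h c))

  private
    index : Carrier → ℕ
    index = Fin.toℕ ∘ Inverse.from enumerate

    index-injective : ∀ {a b} → index a ≡ index b → a ≡ b
    index-injective {a} {b} eq = begin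
      a                                        ≡⟨ sym (Inverse.strictlyInverseˡ enumerate a) ⟩
      Inverse.to enumerate (Inverse.from enumerate a) ≡⟨ cong (Inverse.to enumerate) (FinP.toℕ-injective eq) ⟩
      Inverse.to enumerate (Inverse.from enumerate b) ≡⟨ Inverse.strictlyInverseˡ enumerate b ⟩
      b                                        ∎
      where open ≡-Reasoning

    𝟙<-+-𝟙> : ∀ {m n} → m ≢ n → 𝟙 (m ℕP.<? n) ⊕ 𝟙 (n ℕP.<? m) ≡ + 1
    𝟙<-+-𝟙> {m} {n} m≢n with ℕP.<-cmp m n
    ... | tri< m<n _ n≮m = cong₂ _⊕_ (𝟙-yes (m ℕP.<? n) m<n) (𝟙-no (n ℕP.<? m) n≮m)
    ... | tri≈ _ m≡n _   = ⊥-elim (m≢n m≡n)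
    ... | tri> m≮n _ n<m = cong₂ _⊕_ (𝟙-no (m ℕP.<? n) m≮n) (𝟙-yes (n ℕP.<? m) n<m)

  -- If 1 + 1 = 0 then r ↦ r + 1 is a fixed-point-free involution. L picks the element of smaller
  -- index from each of its orbits {r, r + 1}, so q = 2 ∑ L.
  odd-size⇒1+1≢0 : size % 2 ≡ 1 → 1# + 1# ≢ 0#
  odd-size⇒1+1≢0 odd 1+1≡0 = ℕP.0≢1+n (trans size-even odd)
    where
    shift : Carrier → Carrier
    shift r = r + 1#

    shift-involutive : ∀ r → shift (shift r) ≡ r
    shift-involutive r = trans (+-assoc r 1# 1#) (trans (cong (_+_ r) 1+1≡0) (+-identityʳ r))

    shift-≢ : ∀ r → r ≢ shift r
    shift-≢ r r≡r+1 = 0≢1 (∙-cancelˡ r 0# 1# (trans (+-identityʳ r) r≡r+1))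

    L : Carrier → ℤ
    L r = 𝟙 (index r ℕP.<? index (shift r))

    L-pair : ∀ r → L r ⊕ L (shift r) ≡ + 1
    L-pair r = trans (cong (λ k → L r ⊕ 𝟙 (index (shift r) ℕP.<? k)) (cong index (shift-involutive r)))
                     (𝟙<-+-𝟙> (shift-≢ r ∘ index-injective))

    ∑L+∑L≡size : ∑ℤ allF L ⊕ ∑ℤ allF L ≡ + size
    ∑L+∑L≡size = begin
      ∑ℤ allF L ⊕ ∑ℤ allF L               ≡⟨ cong (∑ℤ allF L ⊕_) (sym (∑ℤ-allF-involution shift shift-involutive L)) ⟩
      ∑ℤ allF L ⊕ ∑[ r ∈ allF ] L (shift r) ≡⟨ sym (∑ℤ-distrib-+ allF L (L ∘ shift)) ⟩
      ∑[ r ∈ allF ] (L r ⊕ L (shift r))   ≡⟨ ∑ℤ-cong allF L-pair ⟩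
      ∑[ r ∈ allF ] (+ 1)                  ≡⟨ ∑ℤ-allF-const (+ 1) ⟩
      + size ⊗ + 1                        ≡⟨ ℤP.*-identityʳ (+ size) ⟩
      + size                              ∎
      where open ≡-Reasoning

    m = ℤ.∣ ∑ℤ allF L ∣

    size≡m*2 : size ≡ m ℕ.* 2
    size≡m*2 = ℤP.+-injective (begin
      + size                 ≡⟨ sym ∑L+∑L≡size ⟩
      ∑ℤ allF L ⊕ ∑ℤ allF L  ≡⟨ sym (cong₂ _⊕_ +m≡∑L +m≡∑L) ⟩
      + m ⊕ + m              ≡⟨ sym (ℤP.pos-+ m m) ⟩
      + (m ℕ.+ m)            ≡⟨ cong +_ (cong (m ℕ.+_) (sym (ℕP.+-identityʳ m)) ⟨ trans ⟩ ℕP.*-comm 2 m) ⟩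
      + (m ℕ.* 2)            ∎)
      where
      open ≡-Reasoning
      +m≡∑L = ℤP.0≤i⇒+∣i∣≡i (∑ℤ-nonneg allF (λ r → 𝟙-nonneg _))

    size-even : 0 ≡ size % 2
    size-even = sym (subst (λ n → n % 2 ≡ 0) (sym size≡m*2) (m*n%n≡0 m 2))

  allVec : ∀ d → List (Vec F d)
  allVec zero    = Vector.[] ∷ []
  allVec (suc d) = concatMap (λ c → map (c Vector.∷_) (allVec d)) allF

  ∑ℤ-allVec-suc : ∀ d (g : Vec F (suc d) → ℤ) →
    ∑ℤ (allVec (suc d)) g ≡ ∑[ c ∈ allF ] ∑[ y ∈ allVec d ] g (c Vector.∷ y)
  ∑ℤ-allVec-suc d g = trans (∑ℤ-concatMap _ allF g) (∑ℤ-cong allF (λ c → ∑ℤ-map (c Vector.∷_) (allVec d) g))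

  ∑ℤ-allVec-const : ∀ d c → ∑[ y ∈ allVec d ] c ≡ q ^ d ⊗ c
  ∑ℤ-allVec-const zero    c = trans (ℤP.+-identityʳ c) (sym (ℤP.*-identityˡ c))
  ∑ℤ-allVec-const (suc d) c = begin
    ∑[ y ∈ allVec (suc d) ] c              ≡⟨ ∑ℤ-allVec-suc d (λ _ → c) ⟩
    ∑[ r ∈ allF ] ∑[ y ∈ allVec d ] c      ≡⟨ ∑ℤ-cong allF (λ _ → ∑ℤ-allVec-const d c) ⟩
    ∑[ r ∈ allF ] (q ^ d ⊗ c)             ≡⟨ ∑ℤ-allF-const (q ^ d ⊗ c) ⟩
    q ⊗ (q ^ d ⊗ c)                       ≡⟨ sym (ℤP.*-assoc q (q ^ d) c) ⟩
    q ^ suc d ⊗ c                         ∎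
    where open ≡-Reasoning

  ∈-allVec : ∀ d (y : Vec F d) → Any (y ≗_) (allVec d)
  ∈-allVec zero    y = here (λ ())
  ∈-allVec (suc d) y = AnyP.concatMap⁺ _
    (Any.map (λ y₀≡c → AnyP.map⁺ (Any.map (y≗ y₀≡c) (∈-allVec d (Vector.tail y)))) (∈-allF (Vector.head y)))
    where
    y≗ : ∀ {c z} → Vector.head y ≡ c → Vector.tail y ≗ z → y ≗ c Vector.∷ z
    y≗ y₀≡c tail≗z zero    = y₀≡c
    y≗ y₀≡c tail≗z (suc i) = tail≗z i

  -- Affine equations

  infix 7 _∙_
  _∙_ : ∀ {d} → Vec F d → Vec F d → Carrier
  u ∙ v = sum (λ j → u j * v j)

  ∙-distrib-⊖ : ∀ {d} (u v y : Vec F d) → (u ⊖ v) ∙ y ≡ u ∙ y - v ∙ y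
  ∙-distrib-⊖ u v y = begin
    (u ⊖ v) ∙ y                                ≡⟨ sum-cong-≗ (λ j → [y-z]x≈yx-zx (y j) (u j) (v j)) ⟩
    sum (λ j → u j * y j + - (v j * y j))      ≡⟨ ∑-distrib-+ (λ j → u j * y j) _ ⟩
    u ∙ y + sum (λ j → - (v j * y j))          ≡⟨ cong (_+_ (u ∙ y)) (sum-neg (λ j → v j * y j)) ⟩
    u ∙ y - v ∙ y                              ∎
    where open ≡-Reasoning

  affine-solutions-≤ : ∀ d (v : Vec F d) k → v k ≢ 0# → ∀ α c →
    q ⊗ ∑[ y ∈ allVec d ] 𝟙 ((α + v ∙ y) ≟ c) ≤ q ^ d
  affine-solutions-≤ (suc d) v zero v₀≢0 α c = begin
    q ⊗ ∑[ y ∈ allVec (suc d) ] 𝟙 ((α + v ∙ y) ≟ c)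
      ≡⟨ cong (q ⊗_) (trans (∑ℤ-allVec-suc d _) (∑ℤ-comm allF (allVec d) _)) ⟩
    q ⊗ ∑[ y ∈ allVec d ] ∑[ r ∈ allF ] 𝟙 ((α + v ∙ (r Vector.∷ y)) ≟ c)
      ≤⟨ ℤP.*-monoˡ-≤-nonNeg q (∑ℤ-mono-≤ (allVec d) (λ y → ∑ℤ-𝟙-≤1 _ allF-unique (unique-root y))) ⟩
    q ⊗ ∑[ y ∈ allVec d ] (+ 1)
      ≡⟨ cong (q ⊗_) (trans (∑ℤ-allVec-const d (+ 1)) (ℤP.*-identityʳ (q ^ d))) ⟩
    q ^ suc d ∎
    where
    open ℤP.≤-Reasoning
    unique-root : ∀ y {r r′} → α + v ∙ (r Vector.∷ y) ≡ c → α + v ∙ (r′ Vector.∷ y) ≡ c → r ≡ r′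
    unique-root y eq eq′ =
      *-cancelˡ-≢0 (v zero) v₀≢0 (∙-cancelʳ _ _ _ (∙-cancelˡ α _ _ (trans eq (sym eq′))))
  affine-solutions-≤ (suc d) v (suc k) vₖ≢0 α c = begin
    q ⊗ ∑[ y ∈ allVec (suc d) ] 𝟙 ((α + v ∙ y) ≟ c)
      ≡⟨ cong (q ⊗_) (∑ℤ-allVec-suc d _) ⟨ trans ⟩ sym (∑ℤ-*ˡ allF q _) ⟩
    ∑[ r ∈ allF ] (q ⊗ ∑[ y ∈ allVec d ] 𝟙 ((α + v ∙ (r Vector.∷ y)) ≟ c))
      ≡⟨ ∑ℤ-cong allF (λ r → cong (q ⊗_) (∑ℤ-cong (allVec d) (λ y →
           𝟙-cong (_ ≟ c) (_ ≟ c) (trans (+-assoc α _ _)) (trans (sym (+-assoc α _ _)))))) ⟩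
    ∑[ r ∈ allF ] (q ⊗ ∑[ y ∈ allVec d ] 𝟙 ((α + v zero * r + Vector.tail v ∙ y) ≟ c))
      ≤⟨ ∑ℤ-mono-≤ allF (λ r → affine-solutions-≤ d (Vector.tail v) k vₖ≢0 (α + v zero * r) c) ⟩
    ∑[ r ∈ allF ] (q ^ d)
      ≡⟨ ∑ℤ-allF-const (q ^ d) ⟩
    q ^ suc d ∎
    where open ℤP.≤-Reasoning

  -- Quadratic forms

  identity-diag : ∀ {d} (i : Fin d) → identity F i i ≡ 1#
  identity-diag i with i Fin.≟ i
  ... | yes _   = refl
  ... | no  i≢i = ⊥-elim (i≢i refl)

  identity-offdiag : ∀ {d} {i j : Fin d} → i ≢ j → identity F i j ≡ 0#
  identity-offdiag {i = i} {j} i≢j with i Fin.≟ j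
  ... | yes i≡j = ⊥-elim (i≢j i≡j)
  ... | no  _   = refl

  sum-identity : ∀ {d} (x : Vec F d) k → sum (λ i → x i * identity F i k) ≡ x k
  sum-identity {suc d} x k = begin
    sum (λ i → x i * identity F i k)                        ≡⟨ sum-remove {i = k} (λ i → x i * identity F i k) ⟩
    x k * identity F k k + sum (λ i → x (punchIn k i) * identity F (punchIn k i) k)
      ≡⟨ cong₂ _+_ (cong (_*_ (x k)) (identity-diag k))
                   (sum-cong-≗ (λ i → cong (_*_ (x (punchIn k i))) (identity-offdiag (FinP.punchInᵢ≢i k i)))) ⟩
    x k * 1# + sum (λ i → x (punchIn k i) * 0#)
      ≡⟨ cong₂ _+_ (*-identityʳ (x k)) (sum-cong-≗ (λ i → zeroʳ (x (punchIn k i))) ⟨ trans ⟩ sum-replicate-zero d) ⟩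
    x k + 0#                                                 ≡⟨ +-identityʳ (x k) ⟩
    x k                                                      ∎
    where open ≡-Reasoning

  module _ {d} (A : Matrix F d) where

    Q : Vec F d → Carrier
    Q = quadForm F A

    Aᵀ : Vec F d → Vec F d
    Aᵀ x j = sum (λ i → A i j * x i)

    ∇Q : Vec F d → Vec F d
    ∇Q x j = Aᵀ x j + Aᵀ x j

    bilinear : Vec F d → Vec F d → Carrier
    bilinear x y = sum (λ i → sum (λ j → A i j * x i * y j))

    Q≡bilinear : ∀ x → Q x ≡ bilinear x x
    Q≡bilinear x =
      trans (∑≡sum (λ i → Defs.∑ F (λ j → A i j * x i * x j))) (sum-cong-≗ (λ i → ∑≡sum (λ j → A i j * x i * x j)))

    Q-cong : ∀ {x x′} → x ≗ x′ → Q x ≡ Q x′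
    Q-cong {x} {x′} x≗x′ = begin
      Q x              ≡⟨ Q≡bilinear x ⟩
      bilinear x x     ≡⟨ sum-cong-≗ (λ i → sum-cong-≗ (λ j → cong₂ (λ u v → A i j * u * v) (x≗x′ i) (x≗x′ j))) ⟩
      bilinear x′ x′   ≡⟨ sym (Q≡bilinear x′) ⟩
      Q x′             ∎
      where open ≡-Reasoning

    bilinear≡Aᵀ∙ : ∀ x y → bilinear x y ≡ Aᵀ x ∙ y
    bilinear≡Aᵀ∙ x y = trans (∑-comm (λ i j → A i j * x i * y j))
                             (sum-cong-≗ (λ j → sym (*-distribʳ-sum (y j) (λ i → A i j * x i))))

    bilinear-sym : Symmetric F A → ∀ x y → bilinear y x ≡ bilinear x y
    bilinear-sym A-sym x y = trans (∑-comm (λ i j → A i j * y i * x j))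
      (sum-cong-≗ (λ j → sum-cong-≗ (λ i → trans (cong (λ a → a * y i * x j) (A-sym i j))
                                                  (swap (A j i) (y i) (x j)))))
      where
      swap : ∀ a u v → a * u * v ≡ a * v * u
      swap = solve 3 (λ a u v → a :* u :* v := a :* v :* u) refl

    private
      sum²-distrib-+ : (f g : Fin d → Fin d → Carrier) →
        sum (λ i → sum (λ j → f i j + g i j)) ≡ sum (λ i → sum (f i)) + sum (λ i → sum (g i))
      sum²-distrib-+ f g =
        trans (sum-cong-≗ (λ i → ∑-distrib-+ (f i) (g i))) (∑-distrib-+ (λ i → sum (f i)) (λ i → sum (g i)))

      polarization-term : ∀ a xᵢ xⱼ yᵢ yⱼ →
        a * (xᵢ - yᵢ) * (xⱼ - yⱼ) + (a * xᵢ * yⱼ + a * yᵢ * xⱼ) ≡ a * xᵢ * xⱼ + a * yᵢ * yⱼ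
      polarization-term a xᵢ xⱼ yᵢ yⱼ = begin
        a * mᵢ * mⱼ + (a * xᵢ * yⱼ + a * yᵢ * xⱼ)
          ≡⟨ sym (cong₂ (λ u v → a * mᵢ * mⱼ + (a * u * yⱼ + a * yᵢ * v)) xᵢ≡ xⱼ≡) ⟩
        a * mᵢ * mⱼ + (a * (mᵢ + yᵢ) * yⱼ + a * yᵢ * (mⱼ + yⱼ))
          ≡⟨ expand a mᵢ mⱼ yᵢ yⱼ ⟩
        a * (mᵢ + yᵢ) * (mⱼ + yⱼ) + a * yᵢ * yⱼ
          ≡⟨ cong₂ (λ u v → a * u * v + a * yᵢ * yⱼ) xᵢ≡ xⱼ≡ ⟩
        a * xᵢ * xⱼ + a * yᵢ * yⱼ ∎
        where
        open ≡-Reasoning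
        mᵢ = xᵢ - yᵢ
        mⱼ = xⱼ - yⱼ
        xᵢ≡ : mᵢ + yᵢ ≡ xᵢ
        xᵢ≡ = //-rightDividesˡ yᵢ xᵢ
        xⱼ≡ : mⱼ + yⱼ ≡ xⱼ
        xⱼ≡ = //-rightDividesˡ yⱼ xⱼ
        expand : ∀ a m n u v → a * m * n + (a * (m + u) * v + a * u * (n + v)) ≡ a * (m + u) * (n + v) + a * u * v
        expand = solve 5 (λ a m n u v → a :* m :* n :+ (a :* (m :+ u) :* v :+ a :* u :* (n :+ v))
                                     := a :* (m :+ u) :* (n :+ v) :+ a :* u :* v) refl

    polarization : ∀ x y → Q (x ⊖ y) + (bilinear x y + bilinear y x) ≡ Q x + Q y
    polarization x y = begin
      Q (x ⊖ y) + (bilinear x y + bilinear y x)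
        ≡⟨ cong₂ _+_ (Q≡bilinear (x ⊖ y)) (sym (sum²-distrib-+ _ _)) ⟩
      bilinear (x ⊖ y) (x ⊖ y) + sum (λ i → sum (λ j → A i j * x i * y j + A i j * y i * x j))
        ≡⟨ sym (sum²-distrib-+ _ _) ⟩
      sum (λ i → sum (λ j → A i j * (x i - y i) * (x j - y j) + (A i j * x i * y j + A i j * y i * x j)))
        ≡⟨ sum-cong-≗ (λ i → sum-cong-≗ (λ j → polarization-term (A i j) (x i) (x j) (y i) (y j))) ⟩
      sum (λ i → sum (λ j → A i j * x i * x j + A i j * y i * y j))
        ≡⟨ sum²-distrib-+ _ _ ⟩
      bilinear x x + bilinear y y
        ≡⟨ sym (cong₂ _+_ (Q≡bilinear x) (Q≡bilinear y)) ⟩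
      Q x + Q y ∎
      where open ≡-Reasoning

    Q-⊖+∇Q∙ : Symmetric F A → ∀ x y → Q (x ⊖ y) + ∇Q x ∙ y ≡ Q x + Q y
    Q-⊖+∇Q∙ A-sym x y = trans (cong (_+_ (Q (x ⊖ y))) ∇Q∙≡) (polarization x y)
      where
      ∇Q∙≡ : ∇Q x ∙ y ≡ bilinear x y + bilinear y x
      ∇Q∙≡ = begin
        ∇Q x ∙ y                ≡⟨ sum-cong-≗ (λ j → distribʳ (y j) (Aᵀ x j) (Aᵀ x j)) ⟩
        sum (λ j → Aᵀ x j * y j + Aᵀ x j * y j)  ≡⟨ ∑-distrib-+ (λ j → Aᵀ x j * y j) (λ j → Aᵀ x j * y j) ⟩
        Aᵀ x ∙ y + Aᵀ x ∙ y     ≡⟨ sym (cong₂ _+_ (bilinear≡Aᵀ∙ x y) (bilinear≡Aᵀ∙ x y)) ⟩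
        bilinear x y + bilinear x y  ≡⟨ cong (_+_ (bilinear x y)) (sym (bilinear-sym A-sym x y)) ⟩
        bilinear x y + bilinear y x  ∎
        where open ≡-Reasoning

    equidistant⇒affine : Symmetric F A → ∀ x x′ y → Q (x′ ⊖ y) ≡ Q (x ⊖ y) → Q x′ + (∇Q x ⊖ ∇Q x′) ∙ y ≡ Q x
    equidistant⇒affine A-sym x x′ y same-distance = ∙-cancelʳ D′ _ _ (begin
      Q x′ + (∇Q x ⊖ ∇Q x′) ∙ y + D′   ≡⟨ cong (λ t → Q x′ + t + D′) (∙-distrib-⊖ (∇Q x) (∇Q x′) y) ⟩
      Q x′ + (D - D′) + D′             ≡⟨ +-assoc (Q x′) (D - D′) D′ ⟩
      Q x′ + (D - D′ + D′)             ≡⟨ cong (_+_ (Q x′)) (//-rightDividesˡ D′ D) ⟩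
      Q x′ + D                         ≡⟨ ∙-cancelʳ (Q y) _ _ (begin
        Q x′ + D + Q y                   ≡⟨ swap₂₃ (Q x′) D (Q y) ⟩
        Q x′ + Q y + D                   ≡⟨ cong (_+ D) (sym (Q-⊖+∇Q∙ A-sym x′ y)) ⟩
        Q (x′ ⊖ y) + D′ + D              ≡⟨ cong (λ t → t + D′ + D) same-distance ⟩
        Q (x ⊖ y) + D′ + D               ≡⟨ swap₂₃ (Q (x ⊖ y)) D′ D ⟩
        Q (x ⊖ y) + D + D′               ≡⟨ cong (_+ D′) (Q-⊖+∇Q∙ A-sym x y) ⟩
        Q x + Q y + D′                   ≡⟨ swap₂₃ (Q x) (Q y) D′ ⟩
        Q x + D′ + Q y                   ∎) ⟩
      Q x + D′                         ∎)
      where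
      open ≡-Reasoning
      D  = ∇Q x ∙ y
      D′ = ∇Q x′ ∙ y
      swap₂₃ : ∀ a b c → a + b + c ≡ a + c + b
      swap₂₃ = solve 3 (λ a b c → a :+ b :+ c := a :+ c :+ b) refl

    Aᵀ-injective : NonSingular F A → ∀ {x x′} → Aᵀ x ≗ Aᵀ x′ → x ≗ x′
    Aᵀ-injective (A⁻¹ , AA⁻¹≡I , _) {x} {x′} Aᵀx≗Aᵀx′ k = begin
      x k                                  ≡⟨ sym (recover x) ⟩
      sum (λ j → Aᵀ x j * A⁻¹ j k)         ≡⟨ sum-cong-≗ (λ j → cong (_* A⁻¹ j k) (Aᵀx≗Aᵀx′ j)) ⟩
      sum (λ j → Aᵀ x′ j * A⁻¹ j k)        ≡⟨ recover x′ ⟩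
      x′ k                                 ∎
      where
      open ≡-Reasoning
      regroup : ∀ a u b → a * u * b ≡ u * (a * b)
      regroup = solve 3 (λ a u b → a :* u :* b := u :* (a :* b)) refl
      recover : ∀ x → sum (λ j → Aᵀ x j * A⁻¹ j k) ≡ x k
      recover x = begin
        sum (λ j → Aᵀ x j * A⁻¹ j k)
          ≡⟨ sum-cong-≗ (λ j → *-distribʳ-sum (A⁻¹ j k) (λ i → A i j * x i)) ⟩
        sum (λ j → sum (λ i → A i j * x i * A⁻¹ j k))
          ≡⟨ ∑-comm (λ j i → A i j * x i * A⁻¹ j k) ⟩
        sum (λ i → sum (λ j → A i j * x i * A⁻¹ j k))
          ≡⟨ sum-cong-≗ (λ i → sum-cong-≗ (λ j → regroup (A i j) (x i) (A⁻¹ j k))) ⟩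
        sum (λ i → sum (λ j → x i * (A i j * A⁻¹ j k)))
          ≡⟨ sum-cong-≗ (λ i → sym (*-distribˡ-sum (x i) (λ j → A i j * A⁻¹ j k))) ⟩
        sum (λ i → x i * sum (λ j → A i j * A⁻¹ j k))
          ≡⟨ sum-cong-≗ (λ i → cong (_*_ (x i)) (trans (sym (∑≡sum (λ j → A i j * A⁻¹ j k))) (AA⁻¹≡I i k))) ⟩
        sum (λ i → x i * identity F i k)
          ≡⟨ sum-identity x k ⟩
        x k ∎

    ∇Q-injective : 1# + 1# ≢ 0# → NonSingular F A → ∀ {x x′} → ∇Q x ≗ ∇Q x′ → x ≗ x′
    ∇Q-injective 2≢0 A-nonsingular ∇Qx≗∇Qx′ = Aᵀ-injective A-nonsingular (x+x-injective 2≢0 ∘ ∇Qx≗∇Qx′)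

    ∇Q-⊖-nonzero : 1# + 1# ≢ 0# → NonSingular F A → ∀ {x x′} → ¬ x ≗ x′ → ∃ λ k → (∇Q x ⊖ ∇Q x′) k ≢ 0#
    ∇Q-⊖-nonzero 2≢0 A-nonsingular x≉x′ = FinP.¬∀⟶∃¬ d _ (λ k → _ ≟ 0#) (λ ∇Qx⊖∇Qx′≡0 →
      x≉x′ (∇Q-injective 2≢0 A-nonsingular (λ k → x∙y⁻¹≈ε⇒x≈y _ _ (∇Qx⊖∇Qx′≡0 k))))

    -- Spheres

    onSphere? : ∀ x (σ : Sphere F d) → Dec (OnSphere F A x σ)
    onSphere? x (y , r) = Q (x ⊖ y) ≟ r

    pointsOn : List (Vec F d) → Sphere F d → ℤ
    pointsOn P σ = ∑[ x ∈ P ] 𝟙 (onSphere? x σ)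

    incidences≡∑pointsOn : ∀ P S → + incidences F A P S ≡ ∑[ σ ∈ S ] pointsOn P σ
    incidences≡∑pointsOn P S = trans (length-filter-cartesianProduct _ P S) (∑ℤ-comm P S _)

    allSpheres : List (Sphere F d)
    allSpheres = concatMap (λ y → map (y ,_) allF) (allVec d)

    ∑ℤ-allSpheres : (g : Sphere F d → ℤ) → ∑ℤ allSpheres g ≡ ∑[ y ∈ allVec d ] ∑[ r ∈ allF ] g (y , r)
    ∑ℤ-allSpheres g = trans (∑ℤ-concatMap _ (allVec d) g) (∑ℤ-cong (allVec d) (λ y → ∑ℤ-map (y ,_) allF g))

    length-allSpheres : + length allSpheres ≡ q ⊗ q ^ d
    length-allSpheres = begin
      + length allSpheres                    ≡⟨ sym (ℤP.*-identityʳ _) ⟩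
      + length allSpheres ⊗ + 1              ≡⟨ sym (∑ℤ-const allSpheres (+ 1)) ⟩
      ∑[ σ ∈ allSpheres ] (+ 1)              ≡⟨ ∑ℤ-allSpheres (λ _ → + 1) ⟩
      ∑[ y ∈ allVec d ] ∑[ r ∈ allF ] (+ 1)  ≡⟨ ∑ℤ-cong (allVec d) (λ _ → ∑ℤ-allF-const (+ 1)) ⟩
      ∑[ y ∈ allVec d ] (q ⊗ + 1)            ≡⟨ ∑ℤ-allVec-const d (q ⊗ + 1) ⟩
      q ^ d ⊗ (q ⊗ + 1)                      ≡⟨ cong (q ^ d ⊗_) (ℤP.*-identityʳ q) ⟨ trans ⟩ ℤP.*-comm (q ^ d) q ⟩
      q ⊗ q ^ d                              ∎
      where open ≡-Reasoning

    sphereSetoid : Setoid 0ℓ 0ℓ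
    sphereSetoid = ×-setoid (Fin d →-setoid Carrier) (setoid Carrier)

    open Setoid sphereSetoid using () renaming (_≈_ to _≈ˢ_)
    open import Data.List.Membership.Setoid sphereSetoid using () renaming (_∈_ to _∈ˢ_)

    ∈ˢ-allSpheres : ∀ σ → σ ∈ˢ allSpheres
    ∈ˢ-allSpheres (y , r) =
      AnyP.concatMap⁺ _ (Any.map (λ y≗y′ → AnyP.map⁺ (Any.map (y≗y′ ,_) (∈-allF r))) (∈-allVec d y))

    pointsOn-cong : ∀ P {σ τ} → σ ≈ˢ τ → pointsOn P σ ≡ pointsOn P τ
    pointsOn-cong P {y , r} {y′ , r′} (y≗y′ , r≡r′) = ∑ℤ-cong P (λ x →
      𝟙-cong (onSphere? x (y , r)) (onSphere? x (y′ , r′))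
        (λ eq → trans (Q-cong (λ i → cong (_-_ (x i)) (sym (y≗y′ i)))) (trans eq r≡r′))
        (λ eq → trans (Q-cong (λ i → cong (_-_ (x i)) (y≗y′ i))) (trans eq (sym r≡r′))))

    ∑pointsOn-allSpheres : ∀ P → ∑[ σ ∈ allSpheres ] pointsOn P σ ≡ q ^ d ⊗ + length P
    ∑pointsOn-allSpheres P = begin
      ∑[ σ ∈ allSpheres ] pointsOn P σ
        ≡⟨ ∑ℤ-allSpheres (pointsOn P) ⟩
      ∑[ y ∈ allVec d ] ∑[ r ∈ allF ] ∑[ x ∈ P ] 𝟙 (Q (x ⊖ y) ≟ r)
        ≡⟨ ∑ℤ-cong (allVec d) (λ y → ∑ℤ-comm allF P _) ⟩
      ∑[ y ∈ allVec d ] ∑[ x ∈ P ] ∑[ r ∈ allF ] 𝟙 (Q (x ⊖ y) ≟ r)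
        ≡⟨ ∑ℤ-cong (allVec d) (λ y → ∑ℤ-cong P (λ x → ∑ℤ-allF-𝟙≟ (Q (x ⊖ y)))) ⟩
      ∑[ y ∈ allVec d ] ∑[ x ∈ P ] (+ 1)
        ≡⟨ ∑ℤ-cong (allVec d) (λ _ → trans (∑ℤ-const P (+ 1)) (ℤP.*-identityʳ _)) ⟩
      ∑[ y ∈ allVec d ] (+ length P)
        ≡⟨ ∑ℤ-allVec-const d (+ length P) ⟩
      q ^ d ⊗ + length P ∎
      where open ≡-Reasoning

    equidistantCentres : Vec F d → Vec F d → ℤ
    equidistantCentres x x′ = ∑[ y ∈ allVec d ] 𝟙 (Q (x′ ⊖ y) ≟ Q (x ⊖ y))

    ∑pointsOn²-allSpheres : ∀ P →
      ∑[ σ ∈ allSpheres ] (pointsOn P σ ⊗ pointsOn P σ) ≡ ∑[ x ∈ P ] ∑[ x′ ∈ P ] equidistantCentres x x′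
    ∑pointsOn²-allSpheres P = begin
      ∑[ σ ∈ allSpheres ] (pointsOn P σ ⊗ pointsOn P σ)
        ≡⟨ ∑ℤ-allSpheres _ ⟩
      ∑[ y ∈ allVec d ] ∑[ r ∈ allF ] (pointsOn P (y , r) ⊗ pointsOn P (y , r))
        ≡⟨ ∑ℤ-cong (allVec d) (λ y → ∑ℤ-cong allF (λ r → ∑ℤ-*-∑ℤ P _ _)) ⟩
      ∑[ y ∈ allVec d ] ∑[ r ∈ allF ] ∑[ x ∈ P ] ∑[ x′ ∈ P ] (𝟙 (Q (x ⊖ y) ≟ r) ⊗ 𝟙 (Q (x′ ⊖ y) ≟ r))
        ≡⟨ ∑ℤ-cong (allVec d) (λ y → trans (∑ℤ-comm allF P _) (∑ℤ-cong P (λ x → ∑ℤ-comm allF P _))) ⟩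
      ∑[ y ∈ allVec d ] ∑[ x ∈ P ] ∑[ x′ ∈ P ] ∑[ r ∈ allF ] (𝟙 (Q (x ⊖ y) ≟ r) ⊗ 𝟙 (Q (x′ ⊖ y) ≟ r))
        ≡⟨ ∑ℤ-cong (allVec d) (λ y → ∑ℤ-cong P (λ x → ∑ℤ-cong P (λ x′ →
             ∑ℤ-allF-sift (Q (x ⊖ y)) (λ r → 𝟙 (Q (x′ ⊖ y) ≟ r))))) ⟩
      ∑[ y ∈ allVec d ] ∑[ x ∈ P ] ∑[ x′ ∈ P ] 𝟙 (Q (x′ ⊖ y) ≟ Q (x ⊖ y))
        ≡⟨ trans (∑ℤ-comm (allVec d) P _) (∑ℤ-cong P (λ x → ∑ℤ-comm (allVec d) P _)) ⟩
      ∑[ x ∈ P ] ∑[ x′ ∈ P ] equidistantCentres x x′ ∎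
      where open ≡-Reasoning

    equidistantCentres-≤ : ∀ x x′ → equidistantCentres x x′ ≤ q ^ d
    equidistantCentres-≤ x x′ = begin
      equidistantCentres x x′        ≤⟨ ∑ℤ-mono-≤ (allVec d) (λ y → 𝟙-≤1 (Q (x′ ⊖ y) ≟ Q (x ⊖ y))) ⟩
      ∑[ y ∈ allVec d ] (+ 1)        ≡⟨ ∑ℤ-allVec-const d (+ 1) ⟩
      q ^ d ⊗ + 1                    ≡⟨ ℤP.*-identityʳ (q ^ d) ⟩
      q ^ d                          ∎
      where open ℤP.≤-Reasoning

    q⊗equidistantCentres-≤ : 1# + 1# ≢ 0# → Symmetric F A → NonSingular F A →
      ∀ x x′ → ¬ x ≗ x′ → q ⊗ equidistantCentres x x′ ≤ q ^ d
    q⊗equidistantCentres-≤ 2≢0 A-sym A-nonsingular x x′ x≉x′ with ∇Q-⊖-nonzero 2≢0 A-nonsingular x≉x′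
    ... | k , vₖ≢0 = begin
      q ⊗ equidistantCentres x x′
        ≤⟨ ℤP.*-monoˡ-≤-nonNeg q (∑ℤ-mono-≤ (allVec d) (λ y →
             𝟙-mono (Q (x′ ⊖ y) ≟ Q (x ⊖ y)) _ (equidistant⇒affine A-sym x x′ y))) ⟩
      q ⊗ ∑[ y ∈ allVec d ] 𝟙 ((Q x′ + (∇Q x ⊖ ∇Q x′) ∙ y) ≟ Q x)
        ≤⟨ affine-solutions-≤ d (∇Q x ⊖ ∇Q x′) k vₖ≢0 (Q x′) (Q x) ⟩
      q ^ d ∎
      where open ℤP.≤-Reasoning

    discrepancy : List (Vec F d) → Sphere F d → ℤ
    discrepancy P σ = q ⊗ pointsOn P σ ℤ.- + length P

    ∑discrepancy≡ : ∀ P S → ∑[ σ ∈ S ] discrepancy P σ ≡ q ⊗ + incidences F A P S ℤ.- + length P ⊗ + length S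
    ∑discrepancy≡ P S = begin
      ∑[ σ ∈ S ] discrepancy P σ
        ≡⟨ ∑ℤ-distrib-- S _ _ ⟩
      ∑[ σ ∈ S ] (q ⊗ pointsOn P σ) ℤ.- ∑[ σ ∈ S ] (+ length P)
        ≡⟨ cong₂ ℤ._-_ (∑ℤ-*ˡ S q (pointsOn P)) (∑ℤ-const S (+ length P)) ⟩
      q ⊗ ∑[ σ ∈ S ] pointsOn P σ ℤ.- + length S ⊗ + length P
        ≡⟨ cong₂ (λ I n → q ⊗ I ℤ.- n) (sym (incidences≡∑pointsOn P S)) (ℤP.*-comm (+ length S) (+ length P)) ⟩
      q ⊗ + incidences F A P S ℤ.- + length P ⊗ + length S ∎
      where open ≡-Reasoning

    module _ (2≢0 : 1# + 1# ≢ 0#) (A-sym : Symmetric F A) (A-nonsingular : NonSingular F A)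
             {P : List (Vec F d)} (P-distinct : AllPairs (DistinctVec F) P) where

      private
        p = + length P

      q⊗∑pointsOn²-≤ :
        q ⊗ ∑[ σ ∈ allSpheres ] (pointsOn P σ ⊗ pointsOn P σ) ≤ p ⊗ (q ⊗ q ^ d) ⊕ (p ⊗ p ℤ.- p) ⊗ q ^ d
      q⊗∑pointsOn²-≤ = begin
        q ⊗ ∑[ σ ∈ allSpheres ] (pointsOn P σ ⊗ pointsOn P σ)
          ≡⟨ cong (q ⊗_) (∑pointsOn²-allSpheres P) ⟩
        q ⊗ ∑[ x ∈ P ] ∑[ x′ ∈ P ] equidistantCentres x x′
          ≡⟨ sym (∑ℤ-*ˡ P q _) ⟨ trans ⟩ ∑ℤ-cong P (λ x → sym (∑ℤ-*ˡ P q _)) ⟩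
        ∑[ x ∈ P ] ∑[ x′ ∈ P ] (q ⊗ equidistantCentres x x′)
          ≤⟨ ∑ℤ-∑ℤ-≤ (_∘ (λ x≗y i → sym (x≗y i))) (λ x x′ → q ⊗ equidistantCentres x x′) _ _
                     (λ x → ℤP.*-monoˡ-≤-nonNeg q (equidistantCentres-≤ x x))
                     (q⊗equidistantCentres-≤ 2≢0 A-sym A-nonsingular _ _) P-distinct ⟩
        p ⊗ (q ⊗ q ^ d) ⊕ (p ⊗ p ℤ.- p) ⊗ q ^ d ∎
        where open ℤP.≤-Reasoning

      ∑discrepancy²-≤ : ∑[ σ ∈ allSpheres ] (discrepancy P σ ⊗ discrepancy P σ) ≤ q ^ suc (suc d) ⊗ p
      ∑discrepancy²-≤ = begin
        ∑[ σ ∈ allSpheres ] (discrepancy P σ ⊗ discrepancy P σ)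
          ≡⟨ ∑ℤ-cong allSpheres (λ σ → expand q (pointsOn P σ) p) ⟩
        ∑[ σ ∈ allSpheres ] (q ⊗ q ⊗ (pointsOn P σ ⊗ pointsOn P σ) ⊕ ℤ.- (+ 2 ⊗ q ⊗ p) ⊗ pointsOn P σ ⊕ p ⊗ p)
          ≡⟨ ∑ℤ-quadratic allSpheres (q ⊗ q) (ℤ.- (+ 2 ⊗ q ⊗ p)) (p ⊗ p) (pointsOn P) ⟩
        q ⊗ q ⊗ S₂ ⊕ ℤ.- (+ 2 ⊗ q ⊗ p) ⊗ ∑[ σ ∈ allSpheres ] pointsOn P σ ⊕ + length allSpheres ⊗ (p ⊗ p)
          ≡⟨ cong₂ (λ S₁ n → q ⊗ q ⊗ S₂ ⊕ ℤ.- (+ 2 ⊗ q ⊗ p) ⊗ S₁ ⊕ n ⊗ (p ⊗ p))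
                   (∑pointsOn-allSpheres P) length-allSpheres ⟩
        q ⊗ q ⊗ S₂ ⊕ ℤ.- (+ 2 ⊗ q ⊗ p) ⊗ (Qd ⊗ p) ⊕ q ⊗ Qd ⊗ (p ⊗ p)
          ≤⟨ ℤP.+-monoˡ-≤ _ (ℤP.+-monoˡ-≤ _ (ℤP.≤-trans (ℤP.≤-reflexive (ℤP.*-assoc q q S₂))
                                                        (ℤP.*-monoˡ-≤-nonNeg q q⊗∑pointsOn²-≤))) ⟩
        q ⊗ (p ⊗ (q ⊗ Qd) ⊕ (p ⊗ p ℤ.- p) ⊗ Qd) ⊕ ℤ.- (+ 2 ⊗ q ⊗ p) ⊗ (Qd ⊗ p) ⊕ q ⊗ Qd ⊗ (p ⊗ p)
          ≡⟨ collect q Qd p ⟩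
        q ⊗ (q ⊗ Qd) ⊗ p ℤ.- q ⊗ Qd ⊗ p
          ≤⟨ ℤP.i-j≤i _ _ {{ℤ.nonNegative 0≤qQdp}} ⟩
        q ⊗ (q ⊗ Qd) ⊗ p ∎
        where
        open ℤP.≤-Reasoning
        Qd = q ^ d
        0≤qQdp = *-nonneg (q ⊗ Qd) p (*-nonneg q Qd (+≤+ ℕ.z≤n) (0≤q^ d)) (+≤+ ℕ.z≤n)
        S₂ = ∑[ σ ∈ allSpheres ] (pointsOn P σ ⊗ pointsOn P σ)
        expand : ∀ q N p → (q ⊗ N ℤ.- p) ⊗ (q ⊗ N ℤ.- p) ≡ q ⊗ q ⊗ (N ⊗ N) ⊕ ℤ.- (+ 2 ⊗ q ⊗ p) ⊗ N ⊕ p ⊗ p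
        expand = solve-∀
        collect : ∀ q Qd p →
          q ⊗ (p ⊗ (q ⊗ Qd) ⊕ (p ⊗ p ℤ.- p) ⊗ Qd) ⊕ ℤ.- (+ 2 ⊗ q ⊗ p) ⊗ (Qd ⊗ p) ⊕ q ⊗ Qd ⊗ (p ⊗ p) ≡
          q ⊗ (q ⊗ Qd) ⊗ p ℤ.- q ⊗ Qd ⊗ p
        collect = solve-∀

open import Defs using (FiniteField; Matrix; Symmetric; NonSingular; PointSet; SphereSet; incidences)
open import Data.Nat as ℕ using (ℕ; _%_)
open import Data.Integer as ℤ using (ℤ; +_; _-_; _*_; _≤_; _^_)
open import Data.List using (length)
open import Data.Product using (proj₁)
open import Relation.Binary.PropositionalEquality using (_≡_)

theorem2p2 : (F : FiniteField) → FiniteField.size F % 2 ≡ 1 →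
    (d : ℕ) (A : Matrix F d) → Symmetric F A → NonSingular F A →
    (P : PointSet F d) (S : SphereSet F d) →
    let q = + FiniteField.size F
        I = + incidences F A (proj₁ P) (proj₁ S)
        p = + length (proj₁ P)
        s = + length (proj₁ S)
    in (q * I - p * s) ^ 2 ≤ q ^ (ℕ.suc (ℕ.suc d)) * p * s
theorem2p2 F odd d A A-sym A-nonsingular (P , P-distinct) (S , S-distinct) = begin
  (q * + incidences F A P S - p * s) ^ 2   ≡⟨ cong (_^ 2) (sym (∑discrepancy≡ A P S)) ⟩
  ∑ℤ S a ^ 2                               ≡⟨ cong (∑ℤ S a *_) (ℤP.*-identityʳ (∑ℤ S a)) ⟩
  ∑ℤ S a * ∑ℤ S a                          ≤⟨ ∑ℤ-square-≤ S a ⟩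
  s * ∑[ σ ∈ S ] (a σ * a σ)               ≤⟨ ℤP.*-monoˡ-≤-nonNeg s ∑S≤∑allSpheres ⟩
  s * ∑[ σ ∈ allSpheres A ] (a σ * a σ)    ≤⟨ ℤP.*-monoˡ-≤-nonNeg s
                                                (∑discrepancy²-≤ A (odd-size⇒1+1≢0 odd) A-sym A-nonsingular P-distinct) ⟩
  s * (q ^ suc (suc d) * p)                ≡⟨ ℤP.*-comm s _ ⟩
  q ^ suc (suc d) * p * s                  ∎
  where
  open ℤP.≤-Reasoning
  open IntegerSum
  open FiniteGeometry F using (q; odd-size⇒1+1≢0; discrepancy; ∑discrepancy≡; ∑discrepancy²-≤;
                               sphereSetoid; allSpheres; ∈ˢ-allSpheres; pointsOn-cong)
  a = discrepancy A P
  p = + length P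
  s = + length S
  ∑S≤∑allSpheres : ∑[ σ ∈ S ] (a σ * a σ) ≤ ∑[ σ ∈ allSpheres A ] (a σ * a σ)
  ∑S≤∑allSpheres = ∑ℤ-mono-⊆ (sphereSetoid A) (λ σ → a σ * a σ)
    (λ σ≈τ → cong (λ N → (q * N - p) * (q * N - p)) (pointsOn-cong A P σ≈τ)) (λ σ → square-nonneg (a σ))
    (allSpheres A) S-distinct (λ {σ} _ → ∈ˢ-allSpheres A σ)
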